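{- Let $n\in\mathbb N$ and let $A\subseteq\mathbb Z_n\setminus\{0\}$ with $A=-A$. Consider the dihedral subgroup $D_{2n}\cong\mathbb Z_n\rtimes\{\pm1\}$ of $\mathrm{Aut}(C_n(A))$, where $(w,t)\in\mathbb Z_n\rtimes\{\pm1\}$ acts on $v\in\mathbb Z_n$ by $(w,t)\cdot v=w+tv$, and let $\mathrm{stab}(A)=\{\gamma\in \mathrm{Aut}(C_n(A)):\gamma(A)=A\}$. Then $\mathrm{stab}(A)\cap D_{2n}=\langle w\rangle\rtimes\{\pm1\}=\{(kw,\pm1):k\in\mathbb Z\}$ for some $w\in\mathbb Z_n$. Moreover, the nonadjacent twin class of $0$ (the set of $u\in\mathbb Z_n$ with $N(u)=N(0)$, including $0$) is $\langle w\rangle$.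
   Context: The circulant graph $C_n(A)$ has vertex set $\mathbb Z_n$, with $u,v$ adjacent iff $u-v\in A$; so $N(u)=u+A$. Distinct vertices $u,v$ are nonadjacent twins if $N(u)=N(v)$. -}

module Defs where

open import Data.Nat using (ℕ; NonZero)
open import Data.Integer using (ℤ; +_; _+_; _*_; -_; _◃_)
open import Data.Integer.DivMod using (_%ℕ_; n%ℕd<d)
open import Data.Fin using (Fin; toℕ; fromℕ<)
open import Data.Fin.Subset using (Subset; _∈_)
open import Data.Sign using (Sign)
open import Data.Product using (∃; ∃-syntax; _×_)
open import Relation.Binary.PropositionalEquality using (_≡_)

-- ℤ_n is represented by Fin n (residues 0,…,n-1); arithmetic is mod n.

[_]ₙ : {n : ℕ} {{_ : NonZero n}} → ℤ → Fin n
[_]ₙ {n} z = fromℕ< (n%ℕd<d z n)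

rep : {n : ℕ} → Fin n → ℤ
rep a = + toℕ a

0ₙ : {n : ℕ} {{_ : NonZero n}} → Fin n
0ₙ = [ + 0 ]ₙ

_⊕_ : {n : ℕ} {{_ : NonZero n}} → Fin n → Fin n → Fin n
a ⊕ b = [ rep a + rep b ]ₙ

⊖_ : {n : ℕ} {{_ : NonZero n}} → Fin n → Fin n
⊖ a = [ - rep a ]ₙ

_·ₙ_ : {n : ℕ} {{_ : NonZero n}} → ℤ → Fin n → Fin n
k ·ₙ a = [ k * rep a ]ₙ

act : {n : ℕ} {{_ : NonZero n}} → Fin n → Sign → Fin n → Fin n
act w t v = [ rep w + (t ◃ toℕ v) ]ₙ

_∈⟨_⟩ : {n : ℕ} {{_ : NonZero n}} → Fin n → Fin n → Set
x ∈⟨ w ⟩ = ∃[ k ] (x ≡ k ·ₙ w)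

_≐_ : {n : ℕ} → (Fin n → Set) → (Fin n → Set) → Set
P ≐ Q = ∀ v → (P v → Q v) × (Q v → P v)

Image : {n : ℕ} → (Fin n → Fin n) → Subset n → Fin n → Set
Image γ A v = ∃[ a ] (a ∈ A × γ a ≡ v)

InStab : {n : ℕ} {{_ : NonZero n}} → Subset n → Fin n → Sign → Set
InStab A w t = Image (act w t) A ≐ (λ v → v ∈ A)

N : {n : ℕ} {{_ : NonZero n}} → Subset n → Fin n → Fin n → Set
N A u v = ∃[ a ] (a ∈ A × v ≡ u ⊕ a)

TwinOf0 : {n : ℕ} {{_ : NonZero n}} → Subset n → Fin n → Set
TwinOf0 A u = N A u ≐ N A 0ₙ

{-# OPTIONS --safe #-}
-- The integers z with A + z = A form a subgroup of ℤ that contains n and is decidable (ℤₙ is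
-- finite), so they are the multiples of its least positive element w, a divisor of n.
-- Both sets of the theorem are described by such translations: (x, ±1) maps A onto A iff
-- translation by x does, since the reflection fixes the symmetric set A; and u is a twin of 0
-- iff u + A = A. Hence both are ⟨w⟩.
module Submission where

open import Defs
open import Data.Nat using (ℕ; zero; suc; pred; NonZero; _<_; s≤s)
import Data.Nat.Properties as ℕ
open import Data.Nat.Properties using (anyUpTo?)
open import Data.Nat.DivMod using (m<n⇒m%n≡m)
open import Data.Nat.Divisibility using (n∣m⇒m%n≡0)
open import Data.Nat.Induction using (<-rec)
open import Data.Integer as ℤ using (ℤ; +_; -[1+_]; 0ℤ; _+_; _*_; -_; _-_; _◃_; ∣_∣)
import Data.Integer.Properties as ℤ
open import Data.Integer.DivMod using (_%ℕ_; _/ℕ_; n%ℕd<d; a≡a%ℕn+[a/ℕn]*n)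
open import Data.Integer.Divisibility.Signed
  using (_∣_; divides; ∣⇒∣ᵤ; ∣m⇒∣-m; ∣m∣n⇒∣m+n; ∣n⇒∣m*n; ∣m+n∣n⇒∣m; ∣-refl; ∣-trans)
open import Data.Integer.Tactic.RingSolver using (solve-∀)
open import Data.Fin using (Fin; toℕ)
open import Data.Fin.Properties using (toℕ-injective; toℕ<n; toℕ-fromℕ<; all?)
open import Data.Fin.Subset using (Subset; _∈_; _∉_)
open import Data.Fin.Subset.Properties using (_∈?_)
open import Data.Sign as Sign using (Sign)
open import Data.Product using (∃-syntax; _×_; _,_; proj₁; proj₂; map₂)
open import Function.Base using (_∘_)
open import Function.Bundles using (_⇔_; mk⇔; Equivalence)
import Function.Properties.Equivalence as ⇔
open import Level using (Level)
open import Relation.Nullary using (¬_; yes; no; contradiction)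
open import Relation.Nullary.Decidable using (Dec; map′; _×-dec_; _→-dec_)
open import Relation.Unary using (Pred; Decidable)
open import Relation.Binary.PropositionalEquality

open Equivalence using (to; from)

private variable
  p : Level

least-witness : {P : Pred ℕ p} → Decidable P → ∀ m → P m → ∃[ w ] (P w × (∀ {j} → j < w → ¬ P j))
least-witness {P = P} P? = <-rec _ search
  where
  search : ∀ m → (∀ {j} → j < m → P j → ∃[ w ] (P w × (∀ {i} → i < w → ¬ P i)))
         → P m → ∃[ w ] (P w × (∀ {i} → i < w → ¬ P i))
  search m below Pm with anyUpTo? P? m
  ... | yes (j , j<m , Pj) = below j<m Pj
  ... | no none            = m , Pm , λ j<m Pj → none (_ , j<m , Pj)

record IsSubgroupOfℤ (P : Pred ℤ p) : Set p where
  field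
    0∈         : P 0ℤ
    +-closed   : ∀ {i j} → P i → P j → P (i + j)
    neg-closed : ∀ {i} → P i → P (- i)

  +*-closed : ∀ {i} → P i → ∀ m → P (+ m * i)
  +*-closed Pi zero        = 0∈
  +*-closed {i} Pi (suc m) = subst P (sym (ℤ.suc-* (+ m) i)) (+-closed Pi (+*-closed Pi m))

  *-closed : ∀ {i} → P i → ∀ k → P (k * i)
  *-closed Pi (+ m)        = +*-closed Pi m
  *-closed {i} Pi -[1+ m ] = subst P (ℤ.neg-distribˡ-* (+ suc m) i) (neg-closed (+*-closed Pi (suc m)))

  least-positive-generates : ∀ {m} → P (+ suc m) → (∀ {j} → j < m → ¬ P (+ suc j))
                           → ∀ z → P z ⇔ + suc m ∣ z
  least-positive-generates {m} Pw least z = mk⇔ member⇒multiple multiple⇒member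
    where
    w q : ℤ
    w = + suc m
    q = z /ℕ suc m
    +-*-cancel : ∀ r q w → r + q * w + - q * w ≡ r
    +-*-cancel = solve-∀
    open ≡-Reasoning
    member⇒multiple : P z → w ∣ z
    member⇒multiple Pz with z %ℕ suc m | a≡a%ℕn+[a/ℕn]*n z (suc m) | n%ℕd<d z (suc m)
    ... | zero  | z≡0+qw | _         = divides q (trans z≡0+qw (ℤ.+-identityˡ (q * w)))
    ... | suc r | z≡r+qw | s≤s r<m   =
      contradiction (subst P remainder (+-closed Pz (*-closed Pw (- q)))) (least r<m)
      where
      remainder : z + - q * w ≡ + suc r
      remainder = begin
        z + - q * w               ≡⟨ cong (λ x → x + - q * w) z≡r+qw ⟩
        + suc r + q * w + - q * w ≡⟨ +-*-cancel (+ suc r) q w ⟩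
        + suc r                   ∎
    multiple⇒member : w ∣ z → P z
    multiple⇒member (divides k refl) = *-closed Pw k

  neg-closed⇔ : ∀ i → P (- i) ⇔ P i
  neg-closed⇔ i = mk⇔ (subst P (ℤ.neg-involutive i) ∘ neg-closed) neg-closed

  decidable⇒cyclic : Decidable P → ∀ m .{{_ : NonZero m}} → P (+ m) → ∃[ w ] (∀ z → P z ⇔ w ∣ z)
  decidable⇒cyclic P? m Pm
    with least-witness (λ j → P? (+ suc j)) (pred m) (subst (P ∘ +_) (sym (ℕ.suc-pred m)) Pm)
  ... | j , Pj , least = + suc j , least-positive-generates Pj least

_⇔-dec_ : ∀ {a b} {X : Set a} {Y : Set b} → Dec X → Dec Y → Dec (X ⇔ Y)
X? ⇔-dec Y? = map′ (λ (f , g) → mk⇔ f g) (λ e → to e , from e) ((X? →-dec Y?) ×-dec (Y? →-dec X?))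

module _ {n : ℕ} where

  ≐⇔pointwise : {P P′ Q Q′ : Fin n → Set} → (∀ v → P v ⇔ P′ v) → (∀ v → Q v ⇔ Q′ v)
              → P ≐ Q ⇔ (∀ v → P′ v ⇔ Q′ v)
  ≐⇔pointwise P⇔P′ Q⇔Q′ = mk⇔
    (λ P≐Q v → ⇔.trans (⇔.sym (P⇔P′ v)) (⇔.trans (mk⇔ (proj₁ (P≐Q v)) (proj₂ (P≐Q v))) (Q⇔Q′ v)))
    (λ P′⇔Q′ v → let P⇔Q = ⇔.trans (P⇔P′ v) (⇔.trans (P′⇔Q′ v) (⇔.sym (Q⇔Q′ v)))
                 in to P⇔Q , from P⇔Q)

  ∈-resp-≡ : ∀ {A : Subset n} {u v} → u ≡ v → u ∈ A ⇔ v ∈ A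
  ∈-resp-≡ refl = ⇔.refl

  Image-inverse : ∀ {f g : Fin n → Fin n} {A} → (∀ a → g (f a) ≡ a) → (∀ u → f (g u) ≡ u)
                → ∀ u → Image f A u ⇔ g u ∈ A
  Image-inverse {f} {g} {A} g∘f f∘g u = mk⇔
    (λ (a , a∈A , fa≡u) → subst (λ v → g v ∈ A) fa≡u (subst (_∈ A) (sym (g∘f a)) a∈A))
    (λ gu∈A → g u , gu∈A , f∘g u)

module Modular (n : ℕ) {{_ : NonZero n}} where

  infix 4 _≡ₙ_
  record _≡ₙ_ (x y : ℤ) : Set where
    constructor mod-n
    field n∣x-y : + n ∣ x - y

  private
    mod-n-by : ∀ {x y d} → d ≡ x - y → + n ∣ d → x ≡ₙ y
    mod-n-by refl n∣d = mod-n n∣d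

  ≡⇒≡ₙ : ∀ {x y} → x ≡ y → x ≡ₙ y
  ≡⇒≡ₙ {x} refl = mod-n (divides 0ℤ (ℤ.+-inverseʳ x))

  ≡ₙ-sym : ∀ {x y} → x ≡ₙ y → y ≡ₙ x
  ≡ₙ-sym {x} {y} (mod-n p) = mod-n-by (identity x y) (∣m⇒∣-m p)
    where identity : ∀ x y → - (x - y) ≡ y - x
          identity = solve-∀

  ≡ₙ-trans : ∀ {x y z} → x ≡ₙ y → y ≡ₙ z → x ≡ₙ z
  ≡ₙ-trans {x} {y} {z} (mod-n p) (mod-n q) = mod-n-by (ℤ.+-minus-telescope x y z) (∣m∣n⇒∣m+n p q)

  +-cong : ∀ {x x′ y y′} → x ≡ₙ x′ → y ≡ₙ y′ → x + y ≡ₙ x′ + y′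
  +-cong {x} {x′} {y} {y′} (mod-n p) (mod-n q) = mod-n-by (identity x x′ y y′) (∣m∣n⇒∣m+n p q)
    where identity : ∀ x x′ y y′ → (x - x′) + (y - y′) ≡ (x + y) - (x′ + y′)
          identity = solve-∀

  +-congˡ : ∀ x {y y′} → y ≡ₙ y′ → x + y ≡ₙ x + y′
  +-congˡ x = +-cong (≡⇒≡ₙ {x} refl)

  neg-cong : ∀ {x x′} → x ≡ₙ x′ → - x ≡ₙ - x′
  neg-cong {x} {x′} (mod-n p) = mod-n-by (identity x x′) (∣m⇒∣-m p)
    where identity : ∀ x x′ → - (x - x′) ≡ - x - - x′
          identity = solve-∀

  *-congˡ : ∀ k {x x′} → x ≡ₙ x′ → k * x ≡ₙ k * x′
  *-congˡ k {x} {x′} (mod-n p) = mod-n-by (identity k x x′) (∣n⇒∣m*n k p)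
    where identity : ∀ k x x′ → k * (x - x′) ≡ k * x - k * x′
          identity = solve-∀

  n≡ₙ0 : + n ≡ₙ 0ℤ
  n≡ₙ0 = mod-n-by (sym (ℤ.+-identityʳ (+ n))) ∣-refl

  residue-unique : ∀ {r s} → r < n → s < n → + r ≡ₙ + s → r ≡ s
  residue-unique {r} {s} r<n s<n (mod-n n∣r-s) =
    ℤ.+-injective (ℤ.i-j≡0⇒i≡j (+ r) (+ s) (ℤ.∣i∣≡0⇒i≡0 distance≡0))
    where
    distance<n : ∣ + r - + s ∣ < n
    distance<n = subst (_< n) (cong ∣_∣ (sym (ℤ.m-n≡m⊖n r s)))
                   (ℕ.≤-<-trans (ℤ.∣m⊝n∣≤m⊔n r s) (ℕ.⊔-lub r<n s<n))
    distance≡0 : ∣ + r - + s ∣ ≡ 0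
    distance≡0 = trans (sym (m<n⇒m%n≡m distance<n)) (n∣m⇒m%n≡0 _ n (∣⇒∣ᵤ n∣r-s))

  rep-injective : ∀ {a b : Fin n} → rep a ≡ₙ rep b → a ≡ b
  rep-injective {a} {b} = toℕ-injective ∘ residue-unique (toℕ<n a) (toℕ<n b)

  rep-[] : ∀ z → rep ([_]ₙ {n} z) ≡ₙ z
  rep-[] z rewrite toℕ-fromℕ< (n%ℕd<d z n) =
    ≡ₙ-sym (mod-n (divides (z /ℕ n)
      (trans (cong (_- + r) (a≡a%ℕn+[a/ℕn]*n z n)) (identity (+ r) (z /ℕ n * + n)))))
    where r = z %ℕ n
          identity : ∀ r a → r + a - r ≡ a
          identity = solve-∀

  []-cong : ∀ {x y} → x ≡ₙ y → [_]ₙ {n} x ≡ [ y ]ₙ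
  []-cong {x} {y} x≡y = rep-injective (≡ₙ-trans (rep-[] x) (≡ₙ-trans x≡y (≡ₙ-sym (rep-[] y))))

  []-rep : ∀ (a : Fin n) → [ rep a ]ₙ ≡ a
  []-rep a = rep-injective (rep-[] (rep a))

  translate : ℤ → Fin n → Fin n
  translate z v = [ z + rep v ]ₙ

  translate-cong : ∀ {z z′} v → z ≡ₙ z′ → translate z v ≡ translate z′ v
  translate-cong v z≡z′ = []-cong (+-cong z≡z′ (≡⇒≡ₙ refl))

  translate-0 : ∀ v → translate 0ℤ v ≡ v
  translate-0 = []-rep

  translate-+ : ∀ z z′ v → translate z (translate z′ v) ≡ translate (z + z′) v
  translate-+ z z′ v =
    []-cong (≡ₙ-trans (+-congˡ z (rep-[] (z′ + rep v))) (≡⇒≡ₙ (sym (ℤ.+-assoc z z′ (rep v)))))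

  translate-cancel : ∀ z z′ → z + z′ ≡ 0ℤ → ∀ v → translate z (translate z′ v) ≡ v
  translate-cancel z z′ z+z′≡0 v = begin
    translate z (translate z′ v) ≡⟨ translate-+ z z′ v ⟩
    translate (z + z′) v         ≡⟨ cong (λ i → translate i v) z+z′≡0 ⟩
    translate 0ℤ v               ≡⟨ translate-0 v ⟩
    v                            ∎
    where open ≡-Reasoning

  translate-inverseˡ : ∀ z v → translate (- z) (translate z v) ≡ v
  translate-inverseˡ z = translate-cancel (- z) z (ℤ.+-inverseˡ z)

  translate-inverseʳ : ∀ z v → translate z (translate (- z) v) ≡ v
  translate-inverseʳ z = translate-cancel z (- z) (ℤ.+-inverseʳ z)

  ⊖-involutive : ∀ (v : Fin n) → ⊖ (⊖ v) ≡ v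
  ⊖-involutive v = begin
    [ - rep (⊖ v) ]ₙ ≡⟨ []-cong (neg-cong (rep-[] (- rep v))) ⟩
    [ - - rep v ]ₙ   ≡⟨ cong [_]ₙ (ℤ.neg-involutive (rep v)) ⟩
    [ rep v ]ₙ       ≡⟨ []-rep v ⟩
    v                ∎
    where open ≡-Reasoning

  reflect : Sign → Fin n → Fin n
  reflect Sign.+ v = v
  reflect Sign.- v = ⊖ v

  reflect-involutive : ∀ t v → reflect t (reflect t v) ≡ v
  reflect-involutive Sign.+ v = refl
  reflect-involutive Sign.- v = ⊖-involutive v

  act≡translate∘reflect : ∀ x t v → act x t v ≡ translate (rep x) (reflect t v)
  act≡translate∘reflect x Sign.+ v = cong (λ i → [ rep x + i ]ₙ) (ℤ.+◃n≡+n (toℕ v))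
  act≡translate∘reflect x Sign.- v = begin
    [ rep x + (Sign.- ◃ toℕ v) ]ₙ ≡⟨ cong (λ i → [ rep x + i ]ₙ) (ℤ.-◃n≡-n (toℕ v)) ⟩
    [ rep x - rep v ]ₙ            ≡⟨ []-cong (+-congˡ (rep x) (≡ₙ-sym (rep-[] (- rep v)))) ⟩
    [ rep x + rep (⊖ v) ]ₙ        ∎
    where open ≡-Reasoning

  ∈⟨⟩⇔∣rep : ∀ {w} → w ∣ + n → ∀ x → x ∈⟨ [ w ]ₙ ⟩ ⇔ w ∣ rep x
  ∈⟨⟩⇔∣rep {w} w∣n x = mk⇔ multiple⇒∣ ∣⇒multiple
    where
    multiple⇒∣ : x ∈⟨ [ w ]ₙ ⟩ → w ∣ rep x
    multiple⇒∣ (k , refl) with ≡ₙ-trans (rep-[] (k * rep ([_]ₙ {n} w))) (*-congˡ k (rep-[] w))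
    ... | mod-n n∣x-kw = ∣m+n∣n⇒∣m (∣-trans w∣n n∣x-kw) (∣m⇒∣-m (∣n⇒∣m*n k ∣-refl))
    ∣⇒multiple : w ∣ rep x → x ∈⟨ [ w ]ₙ ⟩
    ∣⇒multiple (divides k rep-x≡kw) = k , (begin
      x                        ≡⟨ []-rep x ⟨
      [ rep x ]ₙ               ≡⟨ cong [_]ₙ rep-x≡kw ⟩
      [ k * w ]ₙ               ≡⟨ []-cong (*-congˡ k (≡ₙ-sym (rep-[] w))) ⟩
      [ k * rep [ w ]ₙ ]ₙ      ∎)
      where open ≡-Reasoning

  module _ (A : Subset n) where

    Period : ℤ → Set
    Period z = ∀ v → translate z v ∈ A ⇔ v ∈ A

    period? : Decidable Period
    period? z = all? λ v → (translate z v ∈? A) ⇔-dec (v ∈? A)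

    period-isSubgroup : IsSubgroupOfℤ Period
    period-isSubgroup = record
      { 0∈         = λ v → ∈-resp-≡ (translate-0 v)
      ; +-closed   = λ {z} {z′} Pz Pz′ v →
          ⇔.trans (∈-resp-≡ (sym (translate-+ z z′ v))) (⇔.trans (Pz (translate z′ v)) (Pz′ v))
      ; neg-closed = λ {z} Pz v →
          ⇔.trans (⇔.sym (Pz (translate (- z) v))) (∈-resp-≡ (translate-inverseʳ z v))
      }

    n-period : Period (+ n)
    n-period v = ∈-resp-≡ (trans (translate-cong v n≡ₙ0) (translate-0 v))

    reflect-∈ : (∀ a → a ∈ A → ⊖ a ∈ A) → ∀ t v → reflect t v ∈ A ⇔ v ∈ A
    reflect-∈ A-symmetric Sign.+ v = ⇔.refl
    reflect-∈ A-symmetric Sign.- v =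
      mk⇔ (subst (_∈ A) (⊖-involutive v) ∘ A-symmetric (⊖ v)) (A-symmetric v)

    InStab⇔period : (∀ a → a ∈ A → ⊖ a ∈ A) → ∀ x t → InStab A x t ⇔ Period (- rep x)
    InStab⇔period A-symmetric x t = ≐⇔pointwise preimage (λ _ → ⇔.refl)
      where
      open ≡-Reasoning
      act⁻¹ : Fin n → Fin n
      act⁻¹ u = reflect t (translate (- rep x) u)
      act⁻¹∘act : ∀ a → act⁻¹ (act x t a) ≡ a
      act⁻¹∘act a = begin
        reflect t (translate (- rep x) (act x t a))
          ≡⟨ cong (reflect t ∘ translate (- rep x)) (act≡translate∘reflect x t a) ⟩
        reflect t (translate (- rep x) (translate (rep x) (reflect t a)))
          ≡⟨ cong (reflect t) (translate-inverseˡ (rep x) (reflect t a)) ⟩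
        reflect t (reflect t a)
          ≡⟨ reflect-involutive t a ⟩
        a ∎
      act∘act⁻¹ : ∀ u → act x t (act⁻¹ u) ≡ u
      act∘act⁻¹ u = begin
        act x t (act⁻¹ u)
          ≡⟨ act≡translate∘reflect x t (act⁻¹ u) ⟩
        translate (rep x) (reflect t (reflect t (translate (- rep x) u)))
          ≡⟨ cong (translate (rep x)) (reflect-involutive t (translate (- rep x) u)) ⟩
        translate (rep x) (translate (- rep x) u)
          ≡⟨ translate-inverseʳ (rep x) u ⟩
        u ∎
      preimage : ∀ u → Image (act x t) A u ⇔ translate (- rep x) u ∈ A
      preimage u = ⇔.trans (Image-inverse {f = act x t} {act⁻¹} act⁻¹∘act act∘act⁻¹ u)
                           (reflect-∈ A-symmetric t _)

    N⇔translate : ∀ u v → N A u v ⇔ translate (- rep u) v ∈ A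
    N⇔translate u v = ⇔.trans (mk⇔ (map₂ (map₂ sym)) (map₂ (map₂ sym)))
      (Image-inverse {f = translate (rep u)} {translate (- rep u)}
                     (translate-inverseˡ (rep u)) (translate-inverseʳ (rep u)) v)

    TwinOf0⇔period : ∀ u → TwinOf0 A u ⇔ Period (- rep u)
    TwinOf0⇔period u = ≐⇔pointwise (N⇔translate u)
      (λ v → ⇔.trans (N⇔translate 0ₙ v) (∈-resp-≡ (translate-0ₙ v)))
      where
      translate-0ₙ : ∀ v → translate (- rep (0ₙ {n})) v ≡ v
      translate-0ₙ v = trans (translate-cong v (neg-cong (rep-[] 0ℤ))) (translate-0 v)

lemma13 : (n : ℕ) {{_ : NonZero n}} (A : Subset n)
    → 0ₙ ∉ A
    → (∀ a → a ∈ A → ⊖ a ∈ A)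
    → ∃[ w ] ((∀ (x : Fin n) (t : Sign) → InStab A x t ⇔ x ∈⟨ w ⟩)
              × (∀ (u : Fin n) → TwinOf0 A u ⇔ u ∈⟨ w ⟩))
lemma13 n A _ A-symmetric =
  [ w ]ₙ , (λ x t → ⇔.trans (InStab⇔period A A-symmetric x t) (period⇔∈⟨w⟩ x))
         , (λ u → ⇔.trans (TwinOf0⇔period A u) (period⇔∈⟨w⟩ u))
  where
  open Modular n
  open IsSubgroupOfℤ (period-isSubgroup A) using (neg-closed⇔; decidable⇒cyclic)
  cyclic : ∃[ w ] (∀ z → Period A z ⇔ w ∣ z)
  cyclic = decidable⇒cyclic (period? A) n (n-period A)
  w : ℤ
  w = proj₁ cyclic
  period⇔∈⟨w⟩ : ∀ x → Period A (- rep x) ⇔ x ∈⟨ [ w ]ₙ ⟩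
  period⇔∈⟨w⟩ x = ⇔.trans (neg-closed⇔ (rep x)) (⇔.trans (proj₂ cyclic (rep x))
                    (⇔.sym (∈⟨⟩⇔∣rep (to (proj₂ cyclic (+ n)) (n-period A)) x)))
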